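{- A clause-set $F$ has no forced assignments if and only if $F$ is satisfiable and for every literal $x\in\mathrm{lit}(F)$ there is an autarky $\varphi$ for $F$ with $\varphi(x)=1$.
   Context: Literals, clauses (finite sets of literals without complementary pairs), clause-sets; $\mathrm{var}$, $\mathrm{lit}(F)=\mathrm{var}(F)\cup\{\overline v: v\in\mathrm{var}(F)\}$. Partial assignments $\varphi$ (maps from a finite variable set to $\{0,1\}$), $\varphi*F$ deletes clauses with a true literal and deletes false literals; $\top$ is the empty clause-set. $F$ has a forced assignment if there is a literal $x$ with $\langle x\to0\rangle*F$ unsatisfiable. A partial assignment $\varphi$ is an autarky for $F$ iff every clause $C\in F$ with $\mathrm{var}(\varphi)\cap\mathrm{var}(C)\ne\emptyset$ contains a literal set to $1$ by $\varphi$. -}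

module Defs where

open import Data.Nat using (ℕ; _≡ᵇ_)
open import Data.Bool using (Bool; true; false; not; _∧_; _∨_)
open import Data.Bool.Properties using () renaming (_≟_ to _≟𝔹_)
open import Data.Product using (_×_; _,_; proj₁; proj₂; ∃; ∃-syntax)
open import Data.List using (List; []; _∷_; map; filterᵇ)
open import Data.Bool.ListAction using (any)
open import Data.List.Membership.Propositional using (_∈_)
open import Data.List.Relation.Unary.Unique.Propositional using (Unique)
open import Relation.Nullary using (¬_)
open import Relation.Nullary.Decidable using (⌊_⌋)
open import Relation.Binary.PropositionalEquality using (_≡_)

Var : Set
Var = ℕ

-- A literal is a variable together with a polarity:
-- (v , true) is the positive literal v, (v , false) is the negative literal v̄.
Lit : Set
Lit = Var × Bool

var : Lit → Var
var = proj₁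

compl : Lit → Lit
compl (v , b) = (v , not b)

_=ˡ_ : Lit → Lit → Bool
(v , b) =ˡ (w , c) = (v ≡ᵇ w) ∧ ⌊ b ≟𝔹 c ⌋

-- Clauses and clause-sets are represented by lists (read as finite sets).
Clause : Set
Clause = List Lit

ClauseSet : Set
ClauseSet = List Clause

IsClause : Clause → Set
IsClause C = ∀ x → x ∈ C → ¬ (compl x ∈ C)

IsClauseSet : ClauseSet → Set
IsClauseSet F = ∀ C → C ∈ F → IsClause C

-- A partial assignment φ is represented by the list of literals it sets to 1:
-- (v , b) ∈ φ means φ(v) = b.  It must be a function on a finite variable set,
-- i.e. the variables occurring in φ are pairwise distinct.
PAss : Set
PAss = List Lit

IsPAss : PAss → Set
IsPAss φ = Unique (map var φ)

_∈var_ : Var → PAss → Set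
v ∈var φ = v ∈ map var φ

_↦1_ : PAss → Lit → Set
φ ↦1 x = x ∈ φ

trueᵇ : PAss → Lit → Bool
trueᵇ φ x = any (x =ˡ_) φ

falseᵇ : PAss → Lit → Bool
falseᵇ φ x = trueᵇ φ (compl x)

_*_ : PAss → ClauseSet → ClauseSet
φ * F = map (filterᵇ (λ x → not (falseᵇ φ x)))
            (filterᵇ (λ C → not (any (trueᵇ φ) C)) F)

⊤ᶜ : ClauseSet
⊤ᶜ = []

Satisfiable : ClauseSet → Set
Satisfiable F = ∃[ φ ] (IsPAss φ × φ * F ≡ ⊤ᶜ)

⟨_↦0⟩ : Lit → PAss
⟨ x ↦0⟩ = compl x ∷ []

HasForcedAssignment : ClauseSet → Set
HasForcedAssignment F = ∃[ x ] ¬ Satisfiable (⟨ x ↦0⟩ * F)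

-- x ∈ lit(F)  iff  var(x) ∈ var(F)
_∈lit_ : Lit → ClauseSet → Set
x ∈lit F = ∃[ C ] (C ∈ F × ∃[ y ] (y ∈ C × var y ≡ var x))

IsAutarky : PAss → ClauseSet → Set
IsAutarky φ F =
  ∀ C → C ∈ F → (∃[ y ] (y ∈ C × var y ∈var φ)) → ∃[ z ] (z ∈ C × φ ↦1 z)

-- If no literal is forced, then for every literal x the reduct ⟨x̄ → 0⟩ * F is satisfiable,
-- i.e. F has a satisfying assignment setting x to 1, and satisfying assignments are autarkies.
-- Turning "not unsatisfiable" into a satisfying assignment needs satisfiability to be decided,
-- which is a finite backtracking search through the literals of the clauses.
-- Conversely, given x, take an autarky φ with φ(x̄) = 1 (if x ∉ lit(F), ⟨x̄ → 1⟩ itself touches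
-- no clause) and let it override a satisfying assignment ψ: clauses touched by φ are satisfied
-- by φ, the others by ψ.  The result satisfies F and sets x to 0, so ⟨x → 0⟩ * F is satisfiable.

module Submission where

open import Defs
open import Data.Bool using (true; false; not; T)
open import Data.Bool.Properties using (T-∧; not-involutive) renaming (_≟_ to _≟𝔹_)
open import Data.Bool.ListAction using (any)
open import Data.Empty using (⊥-elim)
open import Data.List using ([]; _∷_; map; filter; filterᵇ; _++_)
open import Data.List.Properties using (filter-none)
open import Data.List.Membership.Propositional using (_∈_; _∉_; find; lose)
open import Data.List.Membership.Propositional.Properties
  using (∈-map⁺; ∈-map⁻; ∈-filter⁺; ∈-filter⁻; ∈-++⁺ˡ; ∈-++⁺ʳ; ∉[])
open import Data.List.Relation.Binary.Subset.Propositional using (_⊆_)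
open import Data.List.Relation.Binary.Subset.Propositional.Properties
  using (xs⊆x∷xs; ∈-∷⁺ʳ; ⊆-refl; ⊆-trans)
open import Data.List.Relation.Unary.All as All using (All; []; _∷_)
import Data.List.Relation.Unary.All.Properties as All
open import Data.List.Relation.Unary.AllPairs using ([]; _∷_)
import Data.List.Relation.Unary.AllPairs.Properties as AllPairs
open import Data.List.Relation.Unary.Any as Any using (Any; here; there)
open import Data.List.Relation.Unary.Any.Properties using (any⁺; any⁻)
import Data.Nat as ℕ
open import Data.Nat.Properties using (≡ᵇ⇒≡; ≡⇒≡ᵇ)
open import Data.Product using (_×_; _,_; proj₂; ∃-syntax)
open import Data.Product.Properties using (≡-dec)
open import Data.Sum using (_⊎_; inj₁; inj₂; [_,_])
open import Function using (_∘_; id)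
open import Function.Bundles using (_⇔_; mk⇔; Equivalence)
open import Relation.Binary.PropositionalEquality using (_≡_; _≢_; refl; sym; cong; cong₂; subst)
open import Relation.Nullary using (¬_; Dec; yes; no; ¬?)
open import Relation.Nullary.Decidable using (map′; toWitness; fromWitness; decidable-stable; T?)

open Equivalence using (to; from)

open import Data.List.Membership.DecPropositional (≡-dec ℕ._≟_ _≟𝔹_) using (_∈?_)
open import Data.List.Membership.DecPropositional ℕ._≟_ using () renaming (_∈?_ to _∈ℕ?_)

private variable
  F G : ClauseSet
  C : Clause
  φ ψ σ τ : PAss
  x z : Lit

compl-involutive : ∀ x → compl (compl x) ≡ x
compl-involutive (v , b) = cong (v ,_) (not-involutive b)

compl-≢ : ∀ x → x ≢ compl x
compl-≢ (v , true) ()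
compl-≢ (v , false) ()

var-≡⇒≡⊎≡compl : ∀ x y → var x ≡ var y → x ≡ y ⊎ x ≡ compl y
var-≡⇒≡⊎≡compl (v , true)  (.v , true)  refl = inj₁ refl
var-≡⇒≡⊎≡compl (v , false) (.v , false) refl = inj₁ refl
var-≡⇒≡⊎≡compl (v , true)  (.v , false) refl = inj₂ refl
var-≡⇒≡⊎≡compl (v , false) (.v , true)  refl = inj₂ refl

T-not⇔¬T : ∀ b → T (not b) ⇔ (¬ T b)
T-not⇔¬T true  = mk⇔ (λ ()) (λ ¬t → ¬t _)
T-not⇔¬T false = mk⇔ (λ _ ()) (λ _ → _)

=ˡ⇒≡ : ∀ x y → T (x =ˡ y) → x ≡ y
=ˡ⇒≡ (v , b) (w , c) t =
  let (v≡w , b≡c) = to T-∧ t in cong₂ _,_ (≡ᵇ⇒≡ v w v≡w) (toWitness b≡c)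

=ˡ-refl : ∀ x → T (x =ˡ x)
=ˡ-refl (v , b) = from T-∧ (≡⇒≡ᵇ v v refl , fromWitness refl)

trueᵇ⇔∈ : ∀ φ x → T (trueᵇ φ x) ⇔ x ∈ φ
trueᵇ⇔∈ φ x = mk⇔
  (λ t → Any.map (λ {y} → =ˡ⇒≡ x y) (any⁻ (x =ˡ_) φ t))
  (λ { x∈φ → any⁺ (x =ˡ_) (Any.map (λ { refl → =ˡ-refl x }) x∈φ) })

infix 4 _⊨ᶜ_ _⊨_ _⊨ᶜ?_

_⊨ᶜ_ : PAss → Clause → Set
φ ⊨ᶜ C = Any (_∈ φ) C

_⊨_ : PAss → ClauseSet → Set
φ ⊨ F = All (φ ⊨ᶜ_) F

_⊨ᶜ?_ : ∀ φ C → Dec (φ ⊨ᶜ C)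
φ ⊨ᶜ? C = Any.any? (_∈? φ) C

any-trueᵇ⇔⊨ᶜ : ∀ φ C → T (any (trueᵇ φ) C) ⇔ φ ⊨ᶜ C
any-trueᵇ⇔⊨ᶜ φ C = mk⇔
  (λ t → Any.map (to (trueᵇ⇔∈ φ _)) (any⁻ (trueᵇ φ) C t))
  (λ s → any⁺ (trueᵇ φ) (Any.map (from (trueᵇ⇔∈ φ _)) s))

reduct : PAss → Clause → Clause
reduct φ C = filterᵇ (λ x → not (falseᵇ φ x)) C

∈-reduct⇔ : z ∈ reduct φ C ⇔ (z ∈ C × compl z ∉ φ)
∈-reduct⇔ {z} {φ} = mk⇔
  (λ z∈ → let (z∈C , t) = ∈-filter⁻ (T? ∘ _) z∈ in
          z∈C , to (T-not⇔¬T _) t ∘ from (trueᵇ⇔∈ φ (compl z)))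
  (λ (z∈C , z̄∉φ) → ∈-filter⁺ (T? ∘ _) z∈C (from (T-not⇔¬T _) (z̄∉φ ∘ to (trueᵇ⇔∈ φ (compl z)))))

reduct-∈-* : C ∈ F → ¬ φ ⊨ᶜ C → reduct φ C ∈ φ * F
reduct-∈-* {C} {φ = φ} C∈F φ⊭C =
  ∈-map⁺ (reduct φ) (∈-filter⁺ (T? ∘ _) C∈F (from (T-not⇔¬T _) (φ⊭C ∘ to (any-trueᵇ⇔⊨ᶜ φ C))))

*≡⊤⇔⊨ : φ * F ≡ ⊤ᶜ ⇔ φ ⊨ F
*≡⊤⇔⊨ {φ} {F} = mk⇔
  (λ φ*F≡⊤ → All.tabulate λ {C} C∈F → decidable-stable (φ ⊨ᶜ? C) λ φ⊭C →
     ∉[] (subst (reduct φ C ∈_) φ*F≡⊤ (reduct-∈-* C∈F φ⊭C)))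
  (λ φ⊨F → cong (map (reduct φ)) (filter-none (T? ∘ _)
     (All.map (λ {C} φ⊨C t → to (T-not⇔¬T _) t (from (any-trueᵇ⇔⊨ᶜ φ C) φ⊨C)) φ⊨F)))

IsPAss⇒var-injective : ∀ {x y} → IsPAss τ → x ∈ τ → y ∈ τ → var x ≡ var y → x ≡ y
IsPAss⇒var-injective _        (here refl) (here refl) _ = refl
IsPAss⇒var-injective (h ∷ _)  (here refl) (there y∈)  e = ⊥-elim (All.lookup h (∈-map⁺ var y∈) e)
IsPAss⇒var-injective (h ∷ _)  (there x∈)  (here refl) e = ⊥-elim (All.lookup h (∈-map⁺ var x∈) (sym e))
IsPAss⇒var-injective (_ ∷ u)  (there x∈)  (there y∈)  e = IsPAss⇒var-injective u x∈ y∈ e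

IsPAss⇒consistent : IsPAss τ → z ∈ τ → compl z ∉ τ
IsPAss⇒consistent {z = z} u z∈τ z̄∈τ = compl-≢ z (IsPAss⇒var-injective u z∈τ z̄∈τ refl)

∈var⇒∈⊎compl∈ : var z ∈var φ → z ∈ φ ⊎ compl z ∈ φ
∈var⇒∈⊎compl∈ {z} {φ} v∈ with ∈-map⁻ var v∈
... | y , y∈φ , e with var-≡⇒≡⊎≡compl z y e
...   | inj₁ refl = inj₁ y∈φ
...   | inj₂ refl = inj₂ (subst (_∈ φ) (sym (compl-involutive y)) y∈φ)

∉⇒∉var : z ∉ φ → compl z ∉ φ → ¬ var z ∈var φ
∉⇒∉var z∉φ z̄∉φ = [ z∉φ , z̄∉φ ] ∘ ∈var⇒∈⊎compl∈

∷-IsPAss : IsPAss φ → ¬ var z ∈var φ → IsPAss (z ∷ φ)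
∷-IsPAss {φ} u z∉ = All.¬Any⇒All¬ (map var φ) z∉ ∷ u

∉var? : ∀ φ z → Dec (¬ var z ∈var φ)
∉var? φ z = ¬? (var z ∈ℕ? map var φ)

infixr 5 _⊕_
_⊕_ : PAss → PAss → PAss
φ ⊕ ψ = φ ++ filter (∉var? φ) ψ

∈-⊕⁺ʳ : z ∈ ψ → ¬ var z ∈var φ → z ∈ φ ⊕ ψ
∈-⊕⁺ʳ {φ = φ} z∈ψ z∉ = ∈-++⁺ʳ φ (∈-filter⁺ (∉var? φ) z∈ψ z∉)

⊕-IsPAss : IsPAss φ → IsPAss ψ → IsPAss (φ ⊕ ψ)
⊕-IsPAss {φ} {ψ} uφ uψ = AllPairs.map⁺ (AllPairs.++⁺ (AllPairs.map⁻ uφ)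
  (AllPairs.filter⁺ (∉var? φ) (AllPairs.map⁻ uψ))
  (All.tabulate λ x∈φ → All.tabulate λ y∈ e →
     proj₂ (∈-filter⁻ (∉var? φ) {xs = ψ} y∈) (subst (_∈ map var φ) e (∈-map⁺ var x∈φ))))

⊨-* : IsPAss τ → φ ⊆ τ → τ ⊨ F → τ ⊨ φ * F
⊨-* {τ} {φ} uτ φ⊆τ τ⊨F = All.map⁺ (All.filter⁺ (T? ∘ _) (All.map τ⊨reduct τ⊨F))
  where
  τ⊨reduct : τ ⊨ᶜ C → τ ⊨ᶜ reduct φ C
  τ⊨reduct τ⊨C with find τ⊨C
  ... | z , z∈C , z∈τ = lose (from ∈-reduct⇔ (z∈C , IsPAss⇒consistent uτ z∈τ ∘ φ⊆τ)) z∈τ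

⊨-⊕ : ψ ⊨ φ * F → φ ⊕ ψ ⊨ F
⊨-⊕ {ψ} {φ} {F} ψ⊨φ*F = All.tabulate φ⊕ψ⊨
  where
  φ⊕ψ⊨ : C ∈ F → φ ⊕ ψ ⊨ᶜ C
  φ⊕ψ⊨ {C} C∈F with φ ⊨ᶜ? C
  ... | yes φ⊨C = Any.map ∈-++⁺ˡ φ⊨C
  ... | no φ⊭C with find (All.lookup ψ⊨φ*F (reduct-∈-* C∈F φ⊭C))
  ...   | z , z∈ , z∈ψ with to ∈-reduct⇔ z∈
  ...     | z∈C , z̄∉φ = lose z∈C (∈-⊕⁺ʳ z∈ψ (∉⇒∉var (φ⊭C ∘ lose z∈C) z̄∉φ))

⊨⇒IsAutarky : φ ⊨ F → IsAutarky φ F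
⊨⇒IsAutarky φ⊨F C C∈F _ = find (All.lookup φ⊨F C∈F)

∉lit⇒IsAutarky : ¬ x ∈lit F → IsAutarky (x ∷ []) F
∉lit⇒IsAutarky x∉ C C∈F (y , y∈C , here e) = ⊥-elim (x∉ (C , C∈F , y , y∈C , e))

IsAutarky-⊕-⊨ : IsAutarky φ F → ψ ⊨ F → φ ⊕ ψ ⊨ F
IsAutarky-⊕-⊨ {φ} {F} {ψ} aut ψ⊨F = All.tabulate φ⊕ψ⊨
  where
  φ⊕ψ⊨ : C ∈ F → φ ⊕ ψ ⊨ᶜ C
  φ⊕ψ⊨ {C} C∈F with Any.any? (λ y → var y ∈ℕ? map var φ) C
  ... | yes touched = let (z , z∈C , z∈φ) = aut C C∈F (find touched) in lose z∈C (∈-++⁺ˡ z∈φ)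
  ... | no untouched = let (z , z∈C , z∈ψ) = find (All.lookup ψ⊨F C∈F) in
                       lose z∈C (∈-⊕⁺ʳ z∈ψ (untouched ∘ lose z∈C))

Extensible : PAss → ClauseSet → Set
Extensible σ F = ∃[ τ ] (IsPAss τ × σ ⊆ τ × τ ⊨ F)

Extensible-⊆ : σ ⊆ φ → Extensible φ F → Extensible σ F
Extensible-⊆ σ⊆φ (τ , uτ , φ⊆τ , τ⊨F) = τ , uτ , φ⊆τ ∘ σ⊆φ , τ⊨F

Extensible⇒Satisfiable : Extensible σ F → Satisfiable F
Extensible⇒Satisfiable (τ , uτ , _ , τ⊨F) = τ , uτ , from *≡⊤⇔⊨ τ⊨F

Satisfiable-*⇔Extensible : IsPAss φ → Satisfiable (φ * F) ⇔ Extensible φ F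
Satisfiable-*⇔Extensible {φ} uφ = mk⇔
  (λ (ψ , uψ , ψ*≡⊤) → φ ⊕ ψ , ⊕-IsPAss {ψ = ψ} uφ uψ , ∈-++⁺ˡ , ⊨-⊕ {ψ} (to *≡⊤⇔⊨ ψ*≡⊤))
  (λ (τ , uτ , φ⊆τ , τ⊨F) → τ , uτ , from *≡⊤⇔⊨ (⊨-* uτ φ⊆τ τ⊨F))

IsAutarky⇒Extensible : IsPAss φ → IsAutarky φ F → Satisfiable F → Extensible φ F
IsAutarky⇒Extensible {φ} uφ aut (ψ , uψ , ψ*≡⊤) =
  φ ⊕ ψ , ⊕-IsPAss {ψ = ψ} uφ uψ , ∈-++⁺ˡ , IsAutarky-⊕-⊨ {ψ = ψ} aut (to *≡⊤⇔⊨ ψ*≡⊤)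

Extensible-∷⇔ : Extensible σ (C ∷ G) ⇔ Any (λ z → Extensible (z ∷ σ) G) C
Extensible-∷⇔ {σ} {C} {G} = mk⇔
  (λ { (τ , uτ , σ⊆τ , τ⊨C ∷ τ⊨G) →
        Any.map {Q = λ z → Extensible (z ∷ σ) G} (λ z∈τ → τ , uτ , ∈-∷⁺ʳ z∈τ σ⊆τ , τ⊨G) τ⊨C })
  (λ ext → let (z , z∈C , extz) = find ext in Extensible-∷ z∈C extz)
  where
  Extensible-∷ : z ∈ C → Extensible (z ∷ σ) G → Extensible σ (C ∷ G)
  Extensible-∷ {z} z∈C (τ , uτ , z∷σ⊆τ , τ⊨G) =
    τ , uτ , ⊆-trans (xs⊆x∷xs σ z) z∷σ⊆τ , lose z∈C (z∷σ⊆τ (here refl)) ∷ τ⊨G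

extensible-∷? : (∀ σ → IsPAss σ → Dec (Extensible σ G)) →
                ∀ z σ → IsPAss σ → Dec (Extensible (z ∷ σ) G)
extensible-∷? decide z σ uσ with z ∈? σ | compl z ∈? σ
... | yes z∈σ | _ = map′ (Extensible-⊆ (∈-∷⁺ʳ z∈σ ⊆-refl)) (Extensible-⊆ (xs⊆x∷xs σ z))
                         (decide σ uσ)
... | no _ | yes z̄∈σ = no λ (τ , uτ , z∷σ⊆τ , _) →
                         IsPAss⇒consistent uτ (z∷σ⊆τ (here refl)) (z∷σ⊆τ (there z̄∈σ))
... | no z∉σ | no z̄∉σ = decide (z ∷ σ) (∷-IsPAss {z = z} uσ (∉⇒∉var z∉σ z̄∉σ))

extensible? : ∀ G σ → IsPAss σ → Dec (Extensible σ G)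
extensible? []      σ uσ = yes (σ , uσ , id , [])
extensible? (C ∷ G) σ uσ = map′ (from Extensible-∷⇔) (to Extensible-∷⇔)
  (Any.any? (λ z → extensible-∷? (extensible? G) z σ uσ) C)

¬HasForcedAssignment⇒Extensible : ¬ HasForcedAssignment F → ∀ x → Extensible (x ∷ []) F
¬HasForcedAssignment⇒Extensible {F} unforced x =
  decidable-stable (extensible? F (x ∷ []) ([] ∷ [])) λ ¬ext →
    unforced (compl x , ¬ext ∘ subst (λ y → Extensible (y ∷ []) F) (compl-involutive x)
                             ∘ to (Satisfiable-*⇔Extensible ([] ∷ [])))

_∈lit?_ : ∀ x F → Dec (x ∈lit F)
x ∈lit? F = map′
  (λ occ → let (C , C∈F , occ′) = find occ in C , C∈F , find occ′)
  (λ (C , C∈F , y , y∈C , e) → lose C∈F (lose y∈C e))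
  (Any.any? (λ C → Any.any? (λ y → var y ℕ.≟ var x) C) F)

autarky-for-every-literal : (∀ x → x ∈lit F → ∃[ φ ] (IsPAss φ × IsAutarky φ F × φ ↦1 x)) →
                            ∀ x → ∃[ φ ] (IsPAss φ × IsAutarky φ F × φ ↦1 x)
autarky-for-every-literal {F} aut x with x ∈lit? F
... | yes x∈ = aut x x∈
... | no x∉ = x ∷ [] , [] ∷ [] , ∉lit⇒IsAutarky x∉ , here refl

lemma4p2 : (F : ClauseSet) → IsClauseSet F →
    (¬ HasForcedAssignment F) ⇔
    (Satisfiable F × (∀ x → x ∈lit F → ∃[ φ ] (IsPAss φ × IsAutarky φ F × φ ↦1 x)))
lemma4p2 F _ = mk⇔ unforced⇒ ⇒unforced
  where
  unforced⇒ : ¬ HasForcedAssignment F →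
              Satisfiable F × (∀ x → x ∈lit F → ∃[ φ ] (IsPAss φ × IsAutarky φ F × φ ↦1 x))
  unforced⇒ unforced = Extensible⇒Satisfiable (extensible (0 , true)) , λ x _ →
      let (τ , uτ , x∈τ , τ⊨F) = extensible x in τ , uτ , ⊨⇒IsAutarky τ⊨F , x∈τ (here refl)
    where
    extensible : ∀ x → Extensible (x ∷ []) F
    extensible = ¬HasForcedAssignment⇒Extensible unforced

  ⇒unforced : Satisfiable F × (∀ x → x ∈lit F → ∃[ φ ] (IsPAss φ × IsAutarky φ F × φ ↦1 x)) →
              ¬ HasForcedAssignment F
  ⇒unforced (sat , aut) (x , unsat) =
    let (φ , uφ , autφ , x̄∈φ) = autarky-for-every-literal aut (compl x) in
    unsat (from (Satisfiable-*⇔Extensible ([] ∷ []))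
                (Extensible-⊆ (λ { (here refl) → x̄∈φ }) (IsAutarky⇒Extensible uφ autφ sat)))
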